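{- Let $n,m\ge3$ be odd integers, $S$ and $T$ 2-partitions of $\mathbb{Z}_n^*$ and $\mathbb{Z}_m^*$ respectively, and $X_m$ a nucleus of order $m$. Then an $X$-generated product $W^X_{ST}$ is a starter in $\mathbb{Z}_{mn}$ if and only if $X_m$ is subtractive in $\mathbb{Z}_m$, $S$ is a starter in $\mathbb{Z}_n$, and $T$ is a starter in $\mathbb{Z}_m$.
   Context: $\mathbb{Z}_k^*=\mathbb{Z}_k\setminus\{0\}$; a 2-partition of $\mathbb{Z}_k^*$ ($k$ odd) is a partition into unordered pairs $\{x_i,y_i\}$; it is a starter in $\mathbb{Z}_k$ if $\{\pm(x_i-y_i)\bmod k\}=\mathbb{Z}_k^*$. A nucleus of order $m$ is a set of ordered pairs $X_m=\{(u_i,v_i)\}_{i=1}^{m-1}\subset\mathbb{Z}_m^*\times\mathbb{Z}_m^*$ with $\{u_i\}=\{v_i\}=\mathbb{Z}_m^*$; it is subtractive if $\{(u_i-v_i)\bmod m: 1\le i\le m-1\}=\mathbb{Z}_m^*$. $X$-generated product: with $n=2q+1$, $m=2p+1$, let $\tilde S$ (resp. $\tilde T$) be any set of ordered pairs obtained by ordering each pair of $S$ (resp. $T$) in either way. $W^X_{ST}$ consists of the unordered pairs $\{nr+x,\ nt+y\}$ (mod $nm$, with $x,y$ represented in $\{0,\dots,n-1\}$) of two types: (i$_X$) one pair for each $(x,y)\in\tilde S$ and each $(r,t)\in\{(0,0)\}\cup X_m$; (ii$_X$) one pair for each $(r,t)\in\tilde T$ with $x=y=0$. -}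

module Defs where

open import Data.Nat using (ℕ; zero; suc; _+_; _*_; _∸_; _<_)
open import Data.Nat.DivMod using (_%_)
open import Data.Product using (_×_; _,_; proj₁; proj₂)
open import Data.List using (List; []; _∷_; _++_; map; concatMap; upTo)
open import Data.List.Membership.Propositional using (_∈_)
open import Data.List.Relation.Binary.Permutation.Propositional using (_↭_)
open import Data.List.Relation.Binary.Pointwise using (Pointwise)
open import Data.Sum using (_⊎_)
open import Function.Bundles using (_⇔_)
open import Relation.Binary.PropositionalEquality using (_≡_)

-- residues mod k are represented by natural numbers in {0,…,k-1}
-- reduction modulo k (k = 0 never occurs in the statement; identity there)
modℕ : ℕ → ℕ → ℕ
modℕ zero    a = a
modℕ (suc k) a = a % suc k

subMod : ℕ → ℕ → ℕ → ℕ
subMod k a b = modℕ k (modℕ k a + (k ∸ modℕ k b))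

Zstar : ℕ → ℕ → Set
Zstar k d = 0 < d × d < k

ZstarList : ℕ → List ℕ
ZstarList k = map suc (upTo (k ∸ 1))

entries : List (ℕ × ℕ) → List ℕ
entries = concatMap (λ p → proj₁ p ∷ proj₂ p ∷ [])

-- a list of pairs (each read as an unordered pair) is a 2-partition of ℤ_k^*
IsTwoPartition : ℕ → List (ℕ × ℕ) → Set
IsTwoPartition k P = entries P ↭ ZstarList k

differences : ℕ → List (ℕ × ℕ) → List ℕ
differences k = concatMap (λ p → subMod k (proj₁ p) (proj₂ p) ∷ subMod k (proj₂ p) (proj₁ p) ∷ [])

Starter : ℕ → List (ℕ × ℕ) → Set
Starter k P = IsTwoPartition k P × (∀ d → Zstar k d ⇔ d ∈ differences k P)

Nucleus : ℕ → List (ℕ × ℕ) → Set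
Nucleus m X =
  Data.List.length X ≡ m ∸ 1 ×
  (∀ d → Zstar m d ⇔ d ∈ map proj₁ X) ×
  (∀ d → Zstar m d ⇔ d ∈ map proj₂ X)

Subtractive : ℕ → List (ℕ × ℕ) → Set
Subtractive m X = ∀ d → Zstar m d ⇔ d ∈ map (λ p → subMod m (proj₁ p) (proj₂ p)) X

swap : ℕ × ℕ → ℕ × ℕ
swap (x , y) = y , x

Orientation : List (ℕ × ℕ) → List (ℕ × ℕ) → Set
Orientation P P̃ = Pointwise (λ p q → q ≡ p ⊎ q ≡ swap p) P P̃

XProduct : ℕ → ℕ → List (ℕ × ℕ) → List (ℕ × ℕ) → List (ℕ × ℕ) → List (ℕ × ℕ)
XProduct n m S̃ T̃ X = typeI ++ typeII
  where
  typeI = concatMap (λ xy → map (λ rt → modℕ (n * m) (n * proj₁ rt + proj₁ xy)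
                                      , modℕ (n * m) (n * proj₂ rt + proj₂ xy))
                                ((0 , 0) ∷ X)) S̃
  typeII = map (λ rt → modℕ (n * m) (n * proj₁ rt) , modℕ (n * m) (n * proj₂ rt)) T̃

-- Write a residue mod nm as n q + s with s < n. The difference of a type (i) pair {n r + x, n t + y}
-- is x − y mod n and, for fixed (x, y), it is determined by r − t mod m; the difference of a type (ii)
-- pair {n r, n t} is n (r − t). So if S and T are starters and X_m is subtractive, every element of
-- ℤ_nm^* is a difference: those nonzero mod n come from type (i) pairs, since the r − t over
-- {(0,0)} ∪ X_m cover ℤ_m, and the nonzero multiples of n from type (ii) pairs. Conversely, reducing
-- the differences of W mod n, and dividing its multiples of n by n, shows that S and T are starters.
-- W is always a 2-partition with (nm − 1)/2 pairs, so as a starter its differences are pairwise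
-- distinct; then the difference of {n d + x, y} can only come from a type (i) pair over (x, y), forcing
-- d = u_i − v_i, while u_i = v_i would give {n u_i + x, n u_i + y} and {x, y} the same difference.
module Submission where

open import Defs
open import Data.Bool using (Bool; true; false)
open import Data.Empty using (⊥-elim)
open import Data.List using (List; []; _∷_; _++_; map; concatMap; length; upTo)
open import Data.List.Membership.Propositional using (_∈_; find; lose)
open import Data.List.Membership.Propositional.Properties
  using (∈-map⁺; ∈-map⁻; ∈-++⁺ˡ; ∈-++⁺ʳ; ∈-++⁻; ∈-concatMap⁺; ∈-concatMap⁻; ∈-∃++; ∈-upTo⁺; ∈-upTo⁻)
open import Data.List.Properties using (length-map; length-++; length-upTo)
open import Data.List.Relation.Binary.Permutation.Propositional
  using (_↭_; prep; ↭-refl; ↭-sym; ↭-trans; ↭-swap; ↭⇒↭ₛ)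
open import Data.List.Relation.Binary.Permutation.Propositional.Properties using (∈-resp-↭; shift; ↭-length)
import Data.List.Relation.Binary.Permutation.Setoid.Properties as Permutationₛ
open import Data.List.Relation.Binary.Pointwise using ([]; _∷_)
open import Data.List.Relation.Binary.Subset.Propositional using (_⊆_)
import Data.List.Relation.Unary.All as All
open import Data.List.Relation.Unary.AllPairs using (_∷_)
open import Data.List.Relation.Unary.Any using (here; there)
open import Data.List.Relation.Unary.Unique.Propositional using (Unique)
import Data.List.Relation.Unary.Unique.Propositional.Properties as Unique
open import Data.Nat using (ℕ; zero; suc; _+_; _*_; _∸_; _≤_; _<_; NonZero; >-nonZero⁻¹; z≤n; s≤s)
open import Data.Nat.DivMod hiding (_mod_)
open import Data.Nat.Divisibility using (_∣_; divides; m∣m*n)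
open import Data.Nat.Properties
open import Data.Nat.Tactic.RingSolver using (solve-∀)
open import Data.Product using (_×_; _,_; proj₁; proj₂; ∃; ∃₂; ∃-syntax)
open import Data.Sum using (_⊎_; inj₁; inj₂)
open import Relation.Nullary using (yes; no)
open import Function.Bundles using (_⇔_; mk⇔; module Equivalence)
open import Function.Properties.Equivalence using (⇔-setoid) renaming (trans to ⇔-trans)
open import Level using (0ℓ)
open import Relation.Binary.PropositionalEquality
import Relation.Binary.Reasoning.Setoid as SetoidReasoning
open import Algebra.Properties.CommutativeSemigroup +-commutativeSemigroup using (xy∙z≈xz∙y)

open Equivalence using (to; from)

module ⇔-Reasoning = SetoidReasoning (⇔-setoid 0ℓ)

-- Arithmetic modulo k

infix 4 _≡_mod_
_≡_mod_ : ℕ → ℕ → (k : ℕ) → .{{NonZero k}} → Set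
_≡_mod_ a b k = a % k ≡ b % k

modℕ≡% : ∀ k .{{_ : NonZero k}} a → modℕ k a ≡ a % k
modℕ≡% (suc k) a = refl

modℕ-≡-mod : ∀ k .{{_ : NonZero k}} a → modℕ k a ≡ a mod k
modℕ-≡-mod k a = trans (cong (_% k) (modℕ≡% k a)) (m%n%n≡m%n a k)

subMod≡ : ∀ {k} .{{_ : NonZero k}} a b → subMod k a b ≡ (a % k + (k ∸ b % k)) % k
subMod≡ {suc k} a b = refl

module _ {k : ℕ} .{{_ : NonZero k}} where

  %-≡-+ʳ : ∀ {a b} c → a ≡ b mod k → a + c ≡ b + c mod k
  %-≡-+ʳ {a} {b} c eq = begin
    (a + c) % k           ≡⟨ %-distribˡ-+ a c k ⟩
    (a % k + c % k) % k   ≡⟨ cong (λ x → (x + c % k) % k) eq ⟩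
    (b % k + c % k) % k   ≡⟨ %-distribˡ-+ b c k ⟨
    (b + c) % k           ∎
    where open ≡-Reasoning

  ∣-+-complement : ∀ c → k ∣ c + (k ∸ c % k)
  ∣-+-complement c = divides (suc (c / k)) (begin
    c + c̄                        ≡⟨ cong (_+ c̄) (m≡m%n+[m/n]*n c k) ⟩
    c % k + c / k * k + c̄        ≡⟨ xy∙z≈xz∙y (c % k) (c / k * k) c̄ ⟩
    c % k + c̄ + c / k * k        ≡⟨ cong (_+ c / k * k) (m+[n∸m]≡n (m%n≤n c k)) ⟩
    k + c / k * k                ∎)
    where
    open ≡-Reasoning
    c̄ = k ∸ c % k

  %-cancel-+ʳ : ∀ {a b} c → a + c ≡ b + c mod k → a ≡ b mod k
  %-cancel-+ʳ {a} {b} c eq = begin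
    a % k                ≡⟨ %-remove-+ʳ a (∣-+-complement c) ⟨
    (a + (c + c̄)) % k    ≡⟨ cong (_% k) (+-assoc a c c̄) ⟨
    (a + c + c̄) % k      ≡⟨ %-≡-+ʳ c̄ eq ⟩
    (b + c + c̄) % k      ≡⟨ cong (_% k) (+-assoc b c c̄) ⟩
    (b + (c + c̄)) % k    ≡⟨ %-remove-+ʳ b (∣-+-complement c) ⟩
    b % k                ∎
    where
    open ≡-Reasoning
    c̄ = k ∸ c % k

  %-≡-+ʳ⇔ : ∀ {a b} c → (a + c ≡ b + c mod k) ⇔ (a ≡ b mod k)
  %-≡-+ʳ⇔ c = mk⇔ (%-cancel-+ʳ c) (%-≡-+ʳ c)

  subMod<k : ∀ a b → subMod k a b < k
  subMod<k a b rewrite subMod≡ a b = m%n<n _ k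

  subMod-cong : ∀ {a a′ b b′} → a ≡ a′ mod k → b ≡ b′ mod k → subMod k a b ≡ subMod k a′ b′
  subMod-cong {a} {a′} {b} {b′} eqa eqb = begin
    subMod k a b                   ≡⟨ subMod≡ a b ⟩
    (a % k + (k ∸ b % k)) % k      ≡⟨ cong₂ (λ x y → (x + (k ∸ y)) % k) eqa eqb ⟩
    (a′ % k + (k ∸ b′ % k)) % k    ≡⟨ subMod≡ a′ b′ ⟨
    subMod k a′ b′                 ∎
    where open ≡-Reasoning

  subMod-+ : ∀ a b → subMod k a b + b ≡ a mod k
  subMod-+ a b = begin
    (subMod k a b + b) % k             ≡⟨ %-≡-+ʳ b (trans (cong (_% k) (subMod≡ a b)) (m%n%n≡m%n _ k)) ⟩
    (a % k + (k ∸ b % k) + b) % k      ≡⟨ cong (_% k) (xy∙z≈xz∙y (a % k) (k ∸ b % k) b) ⟩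
    (a % k + b + (k ∸ b % k)) % k      ≡⟨ cong (_% k) (+-assoc (a % k) b (k ∸ b % k)) ⟩
    (a % k + (b + (k ∸ b % k))) % k    ≡⟨ %-remove-+ʳ (a % k) (∣-+-complement b) ⟩
    a % k % k                          ≡⟨ m%n%n≡m%n a k ⟩
    a % k                              ∎
    where open ≡-Reasoning

  subMod-unique : ∀ {a b w} → w < k → w + b ≡ a mod k → subMod k a b ≡ w
  subMod-unique {a} {b} {w} w<k eq = begin
    subMod k a b         ≡⟨ m<n⇒m%n≡m (subMod<k a b) ⟨
    subMod k a b % k     ≡⟨ %-cancel-+ʳ b (trans (subMod-+ a b) (sym eq)) ⟩
    w % k                ≡⟨ m<n⇒m%n≡m w<k ⟩
    w                    ∎
    where open ≡-Reasoning

  subMod-+ʳ : ∀ a b → subMod k (a + b) b ≡ a % k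
  subMod-+ʳ a b = subMod-unique (m%n<n a k) (%-≡-+ʳ b (m%n%n≡m%n a k))

  subMod-self : ∀ a → subMod k a a ≡ 0
  subMod-self a = subMod-unique (>-nonZero⁻¹ k) refl

  subMod-identityʳ : ∀ {a} → a < k → subMod k a 0 ≡ a
  subMod-identityʳ {a} a<k = subMod-unique a<k (cong (_% k) (+-identityʳ a))

  subMod≡0⇒≡ : ∀ {a b} → subMod k a b ≡ 0 → a ≡ b mod k
  subMod≡0⇒≡ {a} {b} eq = trans (sym (subMod-+ a b)) (cong (λ s → (s + b) % k) eq)

  subMod-Zstar : ∀ {a b} → a < k → b < k → a ≢ b → Zstar k (subMod k a b)
  subMod-Zstar {a} {b} a<k b<k a≢b = n≢0⇒n>0 subMod≢0 , subMod<k a b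
    where
    subMod≢0 : subMod k a b ≢ 0
    subMod≢0 eq = a≢b (trans (sym (m<n⇒m%n≡m a<k)) (trans (subMod≡0⇒≡ eq) (m<n⇒m%n≡m b<k)))

  subMod-≡⇔ : ∀ {a b a′ b′} → (subMod k a b ≡ subMod k a′ b′) ⇔ (a + b′ ≡ a′ + b mod k)
  subMod-≡⇔ {a} {b} {a′} {b′} = mk⇔ ⇒ ⇐
    where
    open ≡-Reasoning
    ⇒ : subMod k a b ≡ subMod k a′ b′ → a + b′ ≡ a′ + b mod k
    ⇒ eq = begin
      (a + b′) % k                        ≡⟨ %-≡-+ʳ b′ (subMod-+ a b) ⟨
      (subMod k a b + b + b′) % k         ≡⟨ cong (_% k) (xy∙z≈xz∙y (subMod k a b) b b′) ⟩
      (subMod k a b + b′ + b) % k         ≡⟨ cong (λ s → (s + b′ + b) % k) eq ⟩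
      (subMod k a′ b′ + b′ + b) % k       ≡⟨ %-≡-+ʳ b (subMod-+ a′ b′) ⟩
      (a′ + b) % k                        ∎
    ⇐ : a + b′ ≡ a′ + b mod k → subMod k a b ≡ subMod k a′ b′
    ⇐ eq = sym (subMod-unique (subMod<k a b) (%-cancel-+ʳ b (begin
      (subMod k a b + b′ + b) % k         ≡⟨ cong (_% k) (xy∙z≈xz∙y (subMod k a b) b′ b) ⟩
      (subMod k a b + b + b′) % k         ≡⟨ %-≡-+ʳ b′ (subMod-+ a b) ⟩
      (a + b′) % k                        ≡⟨ eq ⟩
      (a′ + b) % k                        ∎)))

  subMod-flip : ∀ {a b e} → e < k → subMod k a b ≡ subMod k 0 e → subMod k b a ≡ e
  subMod-flip {a} {b} {e} e<k eq =
    subMod-unique e<k (trans (cong (_% k) (+-comm e a)) (to subMod-≡⇔ eq))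

-- Lists of pairs, 2-partitions and starters

Unique-resp-↭ : ∀ {xs ys : List ℕ} → xs ↭ ys → Unique xs → Unique ys
Unique-resp-↭ p = Permutationₛ.Unique-resp-↭ (setoid ℕ) (↭⇒↭ₛ p)

⊆∧length≤⇒↭ : ∀ {xs ys : List ℕ} → Unique xs → xs ⊆ ys → length ys ≤ length xs → ys ↭ xs
⊆∧length≤⇒↭ {[]}     {[]} _            _       _   = ↭-refl
⊆∧length≤⇒↭ {x ∷ xs}      (x∉xs ∷ uxs) x∷xs⊆ys len with ∈-∃++ (x∷xs⊆ys (here refl))
... | us , vs , refl = ↭-trans (shift x us vs) (prep x (⊆∧length≤⇒↭ uxs xs⊆us++vs len′))
  where
  xs⊆us++vs : xs ⊆ us ++ vs
  xs⊆us++vs {y} y∈xs with ∈-resp-↭ (shift x us vs) (x∷xs⊆ys (there y∈xs))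
  ... | here y≡x       = ⊥-elim (All.lookup x∉xs y∈xs (sym y≡x))
  ... | there y∈us++vs = y∈us++vs
  len′ : length (us ++ vs) ≤ length xs
  len′ = ≤-pred (subst (_≤ suc (length xs)) (↭-length (shift x us vs)) len)

length-concatMap-map : ∀ {A B C : Set} (f : A → B → C) xs ys →
                       length (concatMap (λ x → map (f x) ys) xs) ≡ length xs * length ys
length-concatMap-map f []       ys = refl
length-concatMap-map f (x ∷ xs) ys = begin
  length (map (f x) ys ++ concatMap (λ x → map (f x) ys) xs)  ≡⟨ length-++ (map (f x) ys) ⟩
  length (map (f x) ys) + length (concatMap (λ x → map (f x) ys) xs)
    ≡⟨ cong₂ _+_ (length-map (f x) ys) (length-concatMap-map f xs ys) ⟩
  length ys + length xs * length ys  ∎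
  where open ≡-Reasoning

∈-ZstarList⁺ : ∀ {k d} → Zstar k d → d ∈ ZstarList k
∈-ZstarList⁺ {suc k} {suc d} (_ , s≤s d<k) = ∈-map⁺ suc (∈-upTo⁺ d<k)

∈-ZstarList⁻ : ∀ {k d} → d ∈ ZstarList k → Zstar k d
∈-ZstarList⁻ {k} d∈ with ∈-map⁻ suc d∈
... | i , i∈ , refl with k | ∈-upTo⁻ i∈
... | suc _ | i<k = s≤s z≤n , s≤s i<k

ZstarList-unique : ∀ k → Unique (ZstarList k)
ZstarList-unique k = Unique.map⁺ suc-injective (Unique.upTo⁺ (k ∸ 1))

length-ZstarList : ∀ k → length (ZstarList k) ≡ k ∸ 1
length-ZstarList k = trans (length-map suc (upTo (k ∸ 1))) (length-upTo (k ∸ 1))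

pairDiff : ℕ → ℕ × ℕ → ℕ
pairDiff k (x , y) = subMod k x y

orient : Bool → ℕ × ℕ → ℕ × ℕ
orient false p = p
orient true  p = swap p

-- Definitionally, `entries` is `mapBothWays proj₁` and `differences k` is `mapBothWays (pairDiff k)`.
mapBothWays : (ℕ × ℕ → ℕ) → List (ℕ × ℕ) → List ℕ
mapBothWays f = concatMap (λ p → f p ∷ f (swap p) ∷ [])

module _ (f : ℕ × ℕ → ℕ) where

  ∈-mapBothWays⁺ : ∀ o {P p} → p ∈ P → f (orient o p) ∈ mapBothWays f P
  ∈-mapBothWays⁺ false (here refl) = here refl
  ∈-mapBothWays⁺ true  (here refl) = there (here refl)
  ∈-mapBothWays⁺ o     (there p∈)  = there (there (∈-mapBothWays⁺ o p∈))

  ∈-mapBothWays⁻ : ∀ P {d} → d ∈ mapBothWays f P → ∃₂ λ o p → p ∈ P × d ≡ f (orient o p)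
  ∈-mapBothWays⁻ (p ∷ P) (here d≡)         = false , p , here refl , d≡
  ∈-mapBothWays⁻ (p ∷ P) (there (here d≡)) = true , p , here refl , d≡
  ∈-mapBothWays⁻ (p ∷ P) (there (there d∈)) with ∈-mapBothWays⁻ P d∈
  ... | o , q , q∈ , d≡ = o , q , there q∈ , d≡

  length-mapBothWays : ∀ P → length (mapBothWays f P) ≡ length P + length P
  length-mapBothWays []      = refl
  length-mapBothWays (p ∷ P) =
    cong suc (trans (cong suc (length-mapBothWays P)) (sym (+-suc (length P) (length P))))

  mapBothWays-↭ : ∀ {P P̃} → Orientation P P̃ → mapBothWays f P̃ ↭ mapBothWays f P
  mapBothWays-↭ []                 = ↭-refl
  mapBothWays-↭ (inj₁ refl ∷ P∼P̃) = prep _ (prep _ (mapBothWays-↭ P∼P̃))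
  mapBothWays-↭ (inj₂ refl ∷ P∼P̃) = ↭-swap _ _ (mapBothWays-↭ P∼P̃)

  mapBothWays-injective : ∀ {P p p′} o → Unique (mapBothWays f P) → p ∈ P → p′ ∈ P →
                          f (orient o p′) ≡ f p → o ≡ false × p′ ≡ p
  mapBothWays-injective false _ (here refl) (here refl) _ = refl , refl
  mapBothWays-injective true (fp∉ ∷ _) (here refl) (here refl) eq =
    ⊥-elim (All.lookup fp∉ (here refl) (sym eq))
  mapBothWays-injective o (fp∉ ∷ _) (here refl) (there p′∈) eq =
    ⊥-elim (All.lookup fp∉ (there (∈-mapBothWays⁺ o p′∈)) (sym eq))
  mapBothWays-injective false (fp′∉ ∷ _) (there p∈) (here refl) eq =
    ⊥-elim (All.lookup fp′∉ (there (∈-mapBothWays⁺ false p∈)) eq)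
  mapBothWays-injective true (_ ∷ fp′∉ ∷ _) (there p∈) (here refl) eq =
    ⊥-elim (All.lookup fp′∉ (∈-mapBothWays⁺ false p∈) eq)
  mapBothWays-injective o (_ ∷ _ ∷ u) (there p∈) (there p′∈) eq = mapBothWays-injective o u p∈ p′∈ eq

module _ {k : ℕ} {P : List (ℕ × ℕ)} (P-partition : IsTwoPartition k P) where

  partition-Zstar : ∀ {p} → p ∈ P → ∀ o → Zstar k (proj₁ (orient o p))
  partition-Zstar p∈ o = ∈-ZstarList⁻ (∈-resp-↭ P-partition (∈-mapBothWays⁺ proj₁ o p∈))

  partition-size : length P + length P ≡ k ∸ 1
  partition-size = trans (sym (length-mapBothWays proj₁ P)) (trans (↭-length P-partition) (length-ZstarList k))

  partition-nonempty : 2 ≤ k → ∃ λ p → p ∈ P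
  partition-nonempty 2≤k with ∈-mapBothWays⁻ proj₁ P (∈-resp-↭ (↭-sym P-partition) (∈-ZstarList⁺ (s≤s z≤n , 2≤k)))
  ... | _ , p , p∈ , _ = p , p∈

  partition-pair-≢ : ∀ {p} → p ∈ P → proj₁ p ≢ proj₂ p
  partition-pair-≢ p∈ eq with mapBothWays-injective proj₁ true (Unique-resp-↭ (↭-sym P-partition) (ZstarList-unique k)) p∈ p∈ (sym eq)
  ... | () , _

  partition-differences-Zstar : .{{_ : NonZero k}} → ∀ {d} → d ∈ differences k P → Zstar k d
  partition-differences-Zstar d∈ with ∈-mapBothWays⁻ (pairDiff k) P d∈
  ... | false , p , p∈ , refl =
    subMod-Zstar (proj₂ (partition-Zstar p∈ false)) (proj₂ (partition-Zstar p∈ true)) (partition-pair-≢ p∈)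
  ... | true , p , p∈ , refl =
    subMod-Zstar (proj₂ (partition-Zstar p∈ true)) (proj₂ (partition-Zstar p∈ false)) (λ eq → partition-pair-≢ p∈ (sym eq))

orient-partition : ∀ {k P P̃} → Orientation P P̃ → IsTwoPartition k P → IsTwoPartition k P̃
orient-partition P∼P̃ P-partition = ↭-trans (mapBothWays-↭ proj₁ P∼P̃) P-partition

DifferenceCovering : ℕ → List (ℕ × ℕ) → Set
DifferenceCovering k P = ∀ {d} → Zstar k d → d ∈ differences k P

module _ {k : ℕ} .{{_ : NonZero k}} {P : List (ℕ × ℕ)} where

  starter⇒covering : Starter k P → DifferenceCovering k P
  starter⇒covering (_ , diffs) {d} = to (diffs d)

  starter⇔covering : IsTwoPartition k P → Starter k P ⇔ DifferenceCovering k P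
  starter⇔covering P-partition = mk⇔ starter⇒covering
    (λ cover → P-partition , λ d → mk⇔ cover (partition-differences-Zstar {P = P} P-partition))

  starter-differences-unique : Starter k P → Unique (differences k P)
  starter-differences-unique st@(P-partition , _) = Unique-resp-↭ (↭-sym differences↭ZstarList) (ZstarList-unique k)
    where
    differences↭ZstarList : differences k P ↭ ZstarList k
    differences↭ZstarList = ⊆∧length≤⇒↭ (ZstarList-unique k)
      (λ d∈ → starter⇒covering st (∈-ZstarList⁻ d∈))
      (≤-reflexive (trans (length-mapBothWays (pairDiff k) P)
                    (trans (sym (length-mapBothWays proj₁ P)) (↭-length P-partition))))

covering-orientation : ∀ {k P P̃} → Orientation P P̃ → DifferenceCovering k P ⇔ DifferenceCovering k P̃
covering-orientation {k} P∼P̃ = mk⇔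
  (λ cover {_} zd → ∈-resp-↭ (↭-sym (mapBothWays-↭ (pairDiff k) P∼P̃)) (cover zd))
  (λ cover {_} zd → ∈-resp-↭ (mapBothWays-↭ (pairDiff k) P∼P̃) (cover zd))

module _ {m : ℕ} {X : List (ℕ × ℕ)} where

  nucleus-cover : Nucleus m X → ∀ o {q} → q < m → ∃ λ β → β ∈ (0 , 0) ∷ X × proj₁ (orient o β) ≡ q
  nucleus-cover _ false {zero} _ = (0 , 0) , here refl , refl
  nucleus-cover _ true  {zero} _ = (0 , 0) , here refl , refl
  nucleus-cover (_ , us , _) false {suc q} q<m with ∈-map⁻ proj₁ (to (us (suc q)) (s≤s z≤n , q<m))
  ... | β , β∈ , q≡ = β , there β∈ , sym q≡
  nucleus-cover (_ , _ , vs) true {suc q} q<m with ∈-map⁻ proj₂ (to (vs (suc q)) (s≤s z≤n , q<m))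
  ... | β , β∈ , q≡ = β , there β∈ , sym q≡

  subtractive-cover : .{{_ : NonZero m}} → Subtractive m X → ∀ o {e} → e < m →
                      ∃ λ β → β ∈ (0 , 0) ∷ X × pairDiff m (orient o β) ≡ e
  subtractive-cover X-subtractive o {e} e<m = oriented o
    where
    cover : ∀ {e} → e < m → ∃ λ β → β ∈ (0 , 0) ∷ X × pairDiff m β ≡ e
    cover {zero}  _   = (0 , 0) , here refl , subMod-self 0
    cover {suc e} e<m with ∈-map⁻ (pairDiff m) (to (X-subtractive (suc e)) (s≤s z≤n , e<m))
    ... | β , β∈ , e≡ = β , there β∈ , sym e≡
    oriented : ∀ o → ∃ λ β → β ∈ (0 , 0) ∷ X × pairDiff m (orient o β) ≡ e
    oriented false = cover e<m
    oriented true with cover (subMod<k 0 e)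
    ... | β , β∈ , β≡ = β , β∈ , subMod-flip e<m β≡

-- The X-generated product

product-pair-count : ∀ n m .{{_ : NonZero n}} .{{_ : NonZero m}} a b → a + a ≡ n ∸ 1 → b + b ≡ m ∸ 1 →
                     (a * m + b) + (a * m + b) ≡ n * m ∸ 1
product-pair-count (suc _) (suc _) a b refl refl = regroup a b
  where
  regroup : ∀ a b → (a * suc (b + b) + b) + (a * suc (b + b) + b) ≡ (b + b) + (a + a) * suc (b + b)
  regroup = solve-∀

module Product (n m : ℕ) {{_ : NonZero n}} {{_ : NonZero m}} where

  N : ℕ
  N = n * m

  instance
    N≢0 : NonZero N
    N≢0 = m*n≢0 n m

  typeI : ℕ × ℕ → ℕ × ℕ → ℕ × ℕ
  typeI (x , y) (r , t) = modℕ N (n * r + x) , modℕ N (n * t + y)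

  typeII : ℕ × ℕ → ℕ × ℕ
  typeII (r , t) = modℕ N (n * r) , modℕ N (n * t)

  *-%-scale : ∀ a → n * a % N ≡ n * (a % m)
  *-%-scale a = begin
    n * a % N        ≡⟨ cong (_% N) (*-comm n a) ⟩
    a * n % N        ≡⟨ %-congʳ (*-comm n m) ⟩
    a * n % (m * n)  ≡⟨ m%n*o≡m*o%[n*o] a m n ⟨
    a % m * n        ≡⟨ *-comm (a % m) n ⟩
    n * (a % m)      ∎
    where
    open ≡-Reasoning
    instance
      m*n≢0′ : NonZero (m * n)
      m*n≢0′ = m*n≢0 m n

  *-≡-mod⇔ : ∀ {a b} → (n * a ≡ n * b mod N) ⇔ (a ≡ b mod m)
  *-≡-mod⇔ {a} {b} = mk⇔
    (λ eq → *-cancelˡ-≡ (a % m) (b % m) n (trans (sym (*-%-scale a)) (trans eq (*-%-scale b))))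
    (λ eq → trans (*-%-scale a) (trans (cong (n *_) eq) (sym (*-%-scale b))))

  ≡-mod-N⇒≡-mod-n : ∀ {a b} → a ≡ b mod N → a ≡ b mod n
  ≡-mod-N⇒≡-mod-n {a} {b} eq = begin
    a % n        ≡⟨ m∣n⇒o%n%m≡o%m n N a (m∣m*n m) ⟨
    a % N % n    ≡⟨ cong (_% n) eq ⟩
    b % N % n    ≡⟨ m∣n⇒o%n%m≡o%m n N b (m∣m*n m) ⟩
    b % n        ∎
    where open ≡-Reasoning

  subMod-* : ∀ r t → subMod N (n * r) (n * t) ≡ n * subMod m r t
  subMod-* r t = subMod-unique (*-monoʳ-< n (subMod<k r t)) (begin
    (n * e + n * t) % N    ≡⟨ cong (_% N) (*-distribˡ-+ n e t) ⟨
    n * (e + t) % N        ≡⟨ from *-≡-mod⇔ (subMod-+ r t) ⟩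
    n * r % N              ∎)
    where
    open ≡-Reasoning
    e = subMod m r t

  subMod-% : ∀ a b → subMod N a b % n ≡ subMod n a b
  subMod-% a b = sym (subMod-unique (m%n<n s n) (begin
    (s % n + b) % n        ≡⟨ %-≡-+ʳ b (m%n%n≡m%n s n) ⟩
    (s + b) % n            ≡⟨ ≡-mod-N⇒≡-mod-n (subMod-+ a b) ⟩
    a % n                  ∎))
    where
    open ≡-Reasoning
    s = subMod N a b

  pairDiff-typeI : ∀ α β → pairDiff N (typeI α β) ≡ subMod N (n * proj₁ β + proj₁ α) (n * proj₂ β + proj₂ α)
  pairDiff-typeI α β = subMod-cong {k = N} (modℕ-≡-mod N _) (modℕ-≡-mod N _)

  pairDiff-typeI-% : ∀ α β → pairDiff N (typeI α β) % n ≡ pairDiff n α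
  pairDiff-typeI-% α@(a , b) β@(c , d) = begin
    pairDiff N (typeI α β) % n               ≡⟨ cong (_% n) (pairDiff-typeI α β) ⟩
    subMod N (n * c + a) (n * d + b) % n    ≡⟨ subMod-% _ _ ⟩
    subMod n (n * c + a) (n * d + b)        ≡⟨ subMod-cong (%-remove-+ˡ a (m∣m*n {n} c)) (%-remove-+ˡ b (m∣m*n {n} d)) ⟩
    subMod n a b                            ∎
    where open ≡-Reasoning

  pairDiff-typeI-≡⇔ : ∀ α β β′ → (pairDiff N (typeI α β) ≡ pairDiff N (typeI α β′)) ⇔ (pairDiff m β ≡ pairDiff m β′)
  pairDiff-typeI-≡⇔ α@(a , b) β@(c , d) β′@(c′ , d′) = begin
    pairDiff N (typeI α β) ≡ pairDiff N (typeI α β′)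
      ≡⟨ cong₂ _≡_ (pairDiff-typeI α β) (pairDiff-typeI α β′) ⟩
    subMod N (n * c + a) (n * d + b) ≡ subMod N (n * c′ + a) (n * d′ + b)
      ≈⟨ subMod-≡⇔ {k = N} ⟩
    (n * c + a + (n * d′ + b) ≡ n * c′ + a + (n * d + b) mod N)
      ≡⟨ cong₂ (λ x y → x ≡ y mod N) (regroup c a d′ b) (regroup c′ a d b) ⟩
    (n * (c + d′) + (a + b) ≡ n * (c′ + d) + (a + b) mod N)
      ≈⟨ %-≡-+ʳ⇔ {k = N} (a + b) ⟩
    (n * (c + d′) ≡ n * (c′ + d) mod N)
      ≈⟨ *-≡-mod⇔ ⟩
    (c + d′ ≡ c′ + d mod m)
      ≈⟨ subMod-≡⇔ ⟨
    subMod m c d ≡ subMod m c′ d′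
      ∎
    where
    open ⇔-Reasoning
    regroup : ∀ c a d b → n * c + a + (n * d + b) ≡ n * (c + d) + (a + b)
    regroup = distrib n
      where
      distrib : ∀ k c a d b → k * c + a + (k * d + b) ≡ k * (c + d) + (a + b)
      distrib = solve-∀

  pairDiff-typeI-onto : ∀ {z} α → proj₁ α < n → z < N → z % n ≡ pairDiff n α →
                       ∃[ c ] pairDiff N (typeI α (c , 0)) ≡ z
  pairDiff-typeI-onto {z} α@(a , b) a<n z<N z≡ = c , (begin
    pairDiff N (typeI α (c , 0))         ≡⟨ pairDiff-typeI α (c , 0) ⟩
    subMod N (n * c + a) (n * 0 + b)    ≡⟨ cong₂ (subMod N) n*c+a≡z+b (cong (_+ b) (*-zeroʳ n)) ⟩
    subMod N (z + b) b                  ≡⟨ subMod-+ʳ z b ⟩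
    z % N                               ≡⟨ m<n⇒m%n≡m z<N ⟩
    z                                   ∎)
    where
    open ≡-Reasoning
    c = (z + b) / n
    [z+b]%n≡a : (z + b) % n ≡ a
    [z+b]%n≡a = begin
      (z + b) % n               ≡⟨ %-≡-+ʳ b (m%n%n≡m%n z n) ⟨
      (z % n + b) % n           ≡⟨ cong (λ s → (s + b) % n) z≡ ⟩
      (subMod n a b + b) % n    ≡⟨ subMod-+ a b ⟩
      a % n                     ≡⟨ m<n⇒m%n≡m a<n ⟩
      a                         ∎
    n*c+a≡z+b : n * c + a ≡ z + b
    n*c+a≡z+b = begin
      n * c + a                 ≡⟨ +-comm (n * c) a ⟩
      a + n * c                 ≡⟨ cong₂ _+_ [z+b]%n≡a (*-comm c n) ⟨
      (z + b) % n + c * n       ≡⟨ m≡m%n+[m/n]*n (z + b) n ⟨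
      z + b                     ∎

  pairDiff-typeII : ∀ ρ → pairDiff N (typeII ρ) ≡ n * pairDiff m ρ
  pairDiff-typeII (r , t) = trans (subMod-cong {k = N} (modℕ-≡-mod N _) (modℕ-≡-mod N _)) (subMod-* r t)

  n*[z/n]+z%n≡z : ∀ z → n * (z / n) + z % n ≡ z
  n*[z/n]+z%n≡z z = trans (+-comm (n * (z / n)) (z % n)) (trans (cong (z % n +_) (*-comm n (z / n))) (sym (m≡m%n+[m/n]*n z n)))

  /n<m : ∀ {z} → z < N → z / n < m
  /n<m {z} z<N = m<n*o⇒m/o<n (subst (z <_) (*-comm n m) z<N)

  n*-%n : ∀ e → n * e % n ≡ 0
  n*-%n e = trans (cong (_% n) (*-comm n e)) (m*n%n≡0 e n)

  modℕ-digits : ∀ {z} → z < N → modℕ N (n * (z / n) + z % n) ≡ z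
  modℕ-digits {z} z<N = trans (cong (modℕ N) (n*[z/n]+z%n≡z z)) (trans (modℕ≡% N z) (m<n⇒m%n≡m z<N))

  Zstar-<n : ∀ {d} → Zstar n d → Zstar N d
  Zstar-<n (0<d , d<n) = 0<d , <-≤-trans d<n (m≤m*n n m)

  Zstar-n* : ∀ {j} → Zstar m j → Zstar N (n * j)
  Zstar-n* {j} (0<j , j<m) = subst (_< n * j) (*-zeroʳ n) (*-monoʳ-< n 0<j) , *-monoʳ-< n j<m

  Zstar-/n : ∀ {z} → Zstar N z → z % n ≡ 0 → Zstar m (z / n)
  Zstar-/n {z} (0<z , z<N) z%n≡0 = n≢0⇒n>0 z/n≢0 , /n<m z<N
    where
    z/n≢0 : z / n ≢ 0
    z/n≢0 z/n≡0 = <⇒≢ 0<z (begin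
      0                      ≡⟨ *-zeroʳ n ⟨
      n * 0                  ≡⟨ +-identityʳ (n * 0) ⟨
      n * 0 + 0              ≡⟨ cong₂ (λ q s → n * q + s) z/n≡0 z%n≡0 ⟨
      n * (z / n) + z % n    ≡⟨ n*[z/n]+z%n≡z z ⟩
      z                      ∎)
      where open ≡-Reasoning

  typeI-injective₁ : ∀ α β β′ → proj₁ (typeI α β) ≡ proj₁ (typeI α β′) → proj₁ β ≡ proj₁ β′ mod m
  typeI-injective₁ (a , _) (c , _) (c′ , _) eq = to *-≡-mod⇔ (%-cancel-+ʳ {k = N} a
    (trans (sym (modℕ-≡-mod N _)) (trans (cong (_% N) eq) (modℕ-≡-mod N _))))

  orient-typeI : ∀ o α β → orient o (typeI α β) ≡ typeI (orient o α) (orient o β)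
  orient-typeI false _ _ = refl
  orient-typeI true  _ _ = refl

  orient-typeII : ∀ o ρ → orient o (typeII ρ) ≡ typeII (orient o ρ)
  orient-typeII false _ = refl
  orient-typeII true  _ = refl

module XProductOf (n m : ℕ) {{_ : NonZero n}} {{_ : NonZero m}} (S̃ T̃ X : List (ℕ × ℕ)) where

  open Product n m

  W Z₀ : List (ℕ × ℕ)
  W  = XProduct n m S̃ T̃ X
  Z₀ = (0 , 0) ∷ X

  ∈-W-typeI : ∀ {α β} → α ∈ S̃ → β ∈ Z₀ → typeI α β ∈ W
  ∈-W-typeI {α} α∈ β∈ = ∈-++⁺ˡ (∈-concatMap⁺ (λ α → map (typeI α) Z₀) (lose α∈ (∈-map⁺ (typeI α) β∈)))

  ∈-W-typeII : ∀ {ρ} → ρ ∈ T̃ → typeII ρ ∈ W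
  ∈-W-typeII ρ∈ = ∈-++⁺ʳ _ (∈-map⁺ typeII ρ∈)

  ∈-W⁻ : ∀ {q} → q ∈ W → (∃₂ λ α β → α ∈ S̃ × β ∈ Z₀ × q ≡ typeI α β) ⊎ (∃ λ ρ → ρ ∈ T̃ × q ≡ typeII ρ)
  ∈-W⁻ q∈ with ∈-++⁻ _ q∈
  ... | inj₁ q∈I with find (∈-concatMap⁻ (λ α → map (typeI α) Z₀) q∈I)
  ...   | α , α∈ , q∈row with ∈-map⁻ (typeI α) q∈row
  ...     | β , β∈ , refl = inj₁ (α , β , α∈ , β∈ , refl)
  ∈-W⁻ q∈ | inj₂ q∈II with ∈-map⁻ typeII q∈II
  ...   | ρ , ρ∈ , refl = inj₂ (ρ , ρ∈ , refl)

  entries-W-cover : IsTwoPartition n S̃ → IsTwoPartition m T̃ → Nucleus m X → ∀ {z} → Zstar N z → z ∈ entries W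
  entries-W-cover S̃-partition T̃-partition X-nucleus {z} z∈ℤ* with z % n ≟ 0
  ... | yes z%n≡0 with ∈-mapBothWays⁻ proj₁ T̃ (∈-resp-↭ (↭-sym T̃-partition) (∈-ZstarList⁺ (Zstar-/n z∈ℤ* z%n≡0)))
  ...   | o , ρ , ρ∈ , z/n≡ = subst (_∈ entries W) z≡ (∈-mapBothWays⁺ proj₁ o (∈-W-typeII ρ∈))
    where
    open ≡-Reasoning
    z≡ : proj₁ (orient o (typeII ρ)) ≡ z
    z≡ = begin
      proj₁ (orient o (typeII ρ))               ≡⟨ cong proj₁ (orient-typeII o ρ) ⟩
      modℕ N (n * proj₁ (orient o ρ))           ≡⟨ cong (modℕ N) (+-identityʳ _) ⟨
      modℕ N (n * proj₁ (orient o ρ) + 0)       ≡⟨ cong₂ (λ q s → modℕ N (n * q + s)) z/n≡ z%n≡0 ⟨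
      modℕ N (n * (z / n) + z % n)              ≡⟨ modℕ-digits (proj₂ z∈ℤ*) ⟩
      z                                         ∎
  entries-W-cover S̃-partition T̃-partition X-nucleus {z} z∈ℤ* | no z%n≢0
    with ∈-mapBothWays⁻ proj₁ S̃ (∈-resp-↭ (↭-sym S̃-partition) (∈-ZstarList⁺ (n≢0⇒n>0 z%n≢0 , m%n<n z n)))
  ... | o , α , α∈ , z%n≡ with nucleus-cover X-nucleus o (/n<m (proj₂ z∈ℤ*))
  ...   | β , β∈ , z/n≡ = subst (_∈ entries W) z≡ (∈-mapBothWays⁺ proj₁ o (∈-W-typeI α∈ β∈))
    where
    open ≡-Reasoning
    z≡ : proj₁ (orient o (typeI α β)) ≡ z
    z≡ = begin
      proj₁ (orient o (typeI α β))                            ≡⟨ cong proj₁ (orient-typeI o α β) ⟩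
      modℕ N (n * proj₁ (orient o β) + proj₁ (orient o α))    ≡⟨ cong₂ (λ q s → modℕ N (n * q + s)) (sym z/n≡) z%n≡ ⟨
      modℕ N (n * (z / n) + z % n)                            ≡⟨ modℕ-digits (proj₂ z∈ℤ*) ⟩
      z                                                       ∎

  XProduct-partition : IsTwoPartition n S̃ → IsTwoPartition m T̃ → Nucleus m X → IsTwoPartition N W
  XProduct-partition S̃-partition T̃-partition X-nucleus = ⊆∧length≤⇒↭ (ZstarList-unique N)
    (λ z∈ → entries-W-cover S̃-partition T̃-partition X-nucleus (∈-ZstarList⁻ z∈)) (≤-reflexive length-entries)
    where
    open ≡-Reasoning
    length-Z₀ : length Z₀ ≡ m
    length-Z₀ = trans (cong suc (proj₁ X-nucleus)) (suc-pred m)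
    length-W : length W ≡ length S̃ * m + length T̃
    length-W = begin
      length W                                                         ≡⟨ length-++ (concatMap (λ α → map (typeI α) Z₀) S̃) ⟩
      length (concatMap (λ α → map (typeI α) Z₀) S̃) + length (map typeII T̃)
        ≡⟨ cong₂ _+_ (length-concatMap-map typeI S̃ Z₀) (length-map typeII T̃) ⟩
      length S̃ * length Z₀ + length T̃                                 ≡⟨ cong (λ l → length S̃ * l + length T̃) length-Z₀ ⟩
      length S̃ * m + length T̃                                         ∎
    length-entries : length (entries W) ≡ length (ZstarList N)
    length-entries = begin
      length (entries W)                   ≡⟨ length-mapBothWays proj₁ W ⟩
      length W + length W                  ≡⟨ cong (λ l → l + l) length-W ⟩
      (length S̃ * m + length T̃) + (length S̃ * m + length T̃)
        ≡⟨ product-pair-count n m (length S̃) (length T̃) (partition-size {n} {S̃} S̃-partition) (partition-size {m} {T̃} T̃-partition) ⟩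
      N ∸ 1                                ≡⟨ length-ZstarList N ⟨
      length (ZstarList N)                 ∎

  differences-W-typeI : ∀ o {α β} → α ∈ S̃ → β ∈ Z₀ → pairDiff N (typeI (orient o α) (orient o β)) ∈ differences N W
  differences-W-typeI o {α} {β} α∈ β∈ =
    subst (_∈ differences N W) (cong (pairDiff N) (orient-typeI o α β)) (∈-mapBothWays⁺ (pairDiff N) o (∈-W-typeI α∈ β∈))

  differences-W-typeII : ∀ o {ρ} → ρ ∈ T̃ → n * pairDiff m (orient o ρ) ∈ differences N W
  differences-W-typeII o {ρ} ρ∈ =
    subst (_∈ differences N W) (trans (cong (pairDiff N) (orient-typeII o ρ)) (pairDiff-typeII (orient o ρ)))
          (∈-mapBothWays⁺ (pairDiff N) o (∈-W-typeII ρ∈))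

  differences-W⁻ : ∀ {d} → d ∈ differences N W →
    (∃[ o ] ∃₂ λ α β → α ∈ S̃ × β ∈ Z₀ × d ≡ pairDiff N (typeI (orient o α) (orient o β)))
    ⊎ (∃₂ λ o ρ → ρ ∈ T̃ × d ≡ n * pairDiff m (orient o ρ))
  differences-W⁻ d∈ with ∈-mapBothWays⁻ (pairDiff N) W d∈
  ... | o , q , q∈ , d≡ with ∈-W⁻ q∈
  ...   | inj₁ (α , β , α∈ , β∈ , refl) = inj₁ (o , α , β , α∈ , β∈ , trans d≡ (cong (pairDiff N) (orient-typeI o α β)))
  ...   | inj₂ (ρ , ρ∈ , refl) =
    inj₂ (o , ρ , ρ∈ , trans d≡ (trans (cong (pairDiff N) (orient-typeII o ρ)) (pairDiff-typeII (orient o ρ))))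

  covering-S : DifferenceCovering N W → DifferenceCovering n S̃
  covering-S W-covering {d} d∈ℤ*@(0<d , d<n) with differences-W⁻ (W-covering (Zstar-<n d∈ℤ*))
  ... | inj₁ (o , α , β , α∈ , _ , d≡) = subst (_∈ differences n S̃) αdiff≡d (∈-mapBothWays⁺ (pairDiff n) o α∈)
    where
    open ≡-Reasoning
    αdiff≡d : pairDiff n (orient o α) ≡ d
    αdiff≡d = begin
      pairDiff n (orient o α)                              ≡⟨ pairDiff-typeI-% (orient o α) (orient o β) ⟨
      pairDiff N (typeI (orient o α) (orient o β)) % n     ≡⟨ cong (_% n) d≡ ⟨
      d % n                                                ≡⟨ m<n⇒m%n≡m d<n ⟩
      d                                                    ∎
  ... | inj₂ (o , ρ , _ , d≡) = ⊥-elim (<⇒≢ 0<d (begin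
    0                             ≡⟨ n*-%n (pairDiff m (orient o ρ)) ⟨
    n * pairDiff m (orient o ρ) % n ≡⟨ cong (_% n) d≡ ⟨
    d % n                         ≡⟨ m<n⇒m%n≡m d<n ⟩
    d                             ∎))
    where open ≡-Reasoning

  covering-T : IsTwoPartition n S̃ → DifferenceCovering N W → DifferenceCovering m T̃
  covering-T S̃-partition W-covering {j} j∈ℤ* with differences-W⁻ (W-covering (Zstar-n* j∈ℤ*))
  ... | inj₁ (o , α , β , α∈ , _ , nj≡) = ⊥-elim (<⇒≢ 0<αdiff αdiff≡0)
    where
    open ≡-Reasoning
    0<αdiff : 0 < pairDiff n (orient o α)
    0<αdiff = proj₁ (partition-differences-Zstar {P = S̃} S̃-partition (∈-mapBothWays⁺ (pairDiff n) o α∈))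
    αdiff≡0 : 0 ≡ pairDiff n (orient o α)
    αdiff≡0 = begin
      0                                                    ≡⟨ n*-%n j ⟨
      n * j % n                                            ≡⟨ cong (_% n) nj≡ ⟩
      pairDiff N (typeI (orient o α) (orient o β)) % n     ≡⟨ pairDiff-typeI-% (orient o α) (orient o β) ⟩
      pairDiff n (orient o α)                              ∎
  ... | inj₂ (o , ρ , ρ∈ , nj≡) =
    subst (_∈ differences m T̃) (*-cancelˡ-≡ _ _ n (sym nj≡)) (∈-mapBothWays⁺ (pairDiff m) o ρ∈)

  covering-W : IsTwoPartition n S̃ → Subtractive m X → DifferenceCovering n S̃ → DifferenceCovering m T̃ →
               DifferenceCovering N W
  covering-W S̃-partition X-subtractive S̃-covering T̃-covering {z} z∈ℤ* with z % n ≟ 0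
  ... | yes z%n≡0 with ∈-mapBothWays⁻ (pairDiff m) T̃ (T̃-covering (Zstar-/n z∈ℤ* z%n≡0))
  ...   | o , ρ , ρ∈ , z/n≡ = subst (_∈ differences N W) ρdiff≡z (differences-W-typeII o ρ∈)
    where
    open ≡-Reasoning
    ρdiff≡z : n * pairDiff m (orient o ρ) ≡ z
    ρdiff≡z = begin
      n * pairDiff m (orient o ρ)   ≡⟨ cong (n *_) z/n≡ ⟨
      n * (z / n)                   ≡⟨ +-identityʳ _ ⟨
      n * (z / n) + 0               ≡⟨ cong (n * (z / n) +_) z%n≡0 ⟨
      n * (z / n) + z % n           ≡⟨ n*[z/n]+z%n≡z z ⟩
      z                             ∎
  covering-W S̃-partition X-subtractive S̃-covering T̃-covering {z} z∈ℤ* | no z%n≢0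
    with ∈-mapBothWays⁻ (pairDiff n) S̃ (S̃-covering (n≢0⇒n>0 z%n≢0 , m%n<n z n))
  ... | o , α , α∈ , z%n≡ with pairDiff-typeI-onto (orient o α) (proj₂ (partition-Zstar S̃-partition α∈ o)) (proj₂ z∈ℤ*) z%n≡
  ...   | c , typeI≡z with subtractive-cover X-subtractive o (subMod<k c 0)
  ...     | β , β∈ , β≡ = subst (_∈ differences N W)
    (trans (from (pairDiff-typeI-≡⇔ (orient o α) (orient o β) (c , 0)) β≡) typeI≡z) (differences-W-typeI o α∈ β∈)

  subtractive : 2 ≤ n → IsTwoPartition n S̃ → Nucleus m X → Starter N W → Subtractive m X
  subtractive 2≤n S̃-partition X-nucleus W-starter d with partition-nonempty S̃-partition 2≤n
  ... | α , α∈ = mk⇔ covered nonzero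
    where
    open ≡-Reasoning
    W-covering : DifferenceCovering N W
    W-covering = starter⇒covering {P = W} W-starter
    S̃-unique : Unique (differences n S̃)
    S̃-unique = starter-differences-unique {P = S̃} (from (starter⇔covering {P = S̃} S̃-partition) (covering-S W-covering))
    0<αdiff : 0 < pairDiff n α
    0<αdiff = proj₁ (partition-differences-Zstar {P = S̃} S̃-partition (∈-mapBothWays⁺ (pairDiff n) false α∈))

    z : ℕ
    z = pairDiff N (typeI α (d , 0))
    z%n≡αdiff : z % n ≡ pairDiff n α
    z%n≡αdiff = pairDiff-typeI-% α (d , 0)
    z∈ℤ* : Zstar N z
    z∈ℤ* = n≢0⇒n>0 z≢0 , subMod<k _ _
      where
      z≢0 : z ≢ 0
      z≢0 z≡0 = <⇒≢ 0<αdiff (begin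
        0               ≡⟨ m<n⇒m%n≡m (>-nonZero⁻¹ n) ⟨
        0 % n           ≡⟨ cong (_% n) z≡0 ⟨
        z % n           ≡⟨ z%n≡αdiff ⟩
        pairDiff n α    ∎)

    covered : Zstar m d → d ∈ map (pairDiff m) X
    covered (0<d , d<m) with differences-W⁻ (W-covering z∈ℤ*)
    ... | inj₂ (o , ρ , _ , z≡) = ⊥-elim (<⇒≢ 0<αdiff (begin
      0                                ≡⟨ n*-%n (pairDiff m (orient o ρ)) ⟨
      n * pairDiff m (orient o ρ) % n  ≡⟨ cong (_% n) z≡ ⟨
      z % n                            ≡⟨ z%n≡αdiff ⟩
      pairDiff n α                     ∎))
    ... | inj₁ (o , α′ , β , α′∈ , β∈ , z≡) with mapBothWays-injective (pairDiff n) o S̃-unique α∈ α′∈ (begin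
      pairDiff n (orient o α′)                             ≡⟨ pairDiff-typeI-% (orient o α′) (orient o β) ⟨
      pairDiff N (typeI (orient o α′) (orient o β)) % n    ≡⟨ cong (_% n) z≡ ⟨
      z % n                                                ≡⟨ z%n≡αdiff ⟩
      pairDiff n α                                         ∎)
    ...   | refl , refl with trans (sym (subMod-identityʳ d<m)) (to (pairDiff-typeI-≡⇔ α (d , 0) β) z≡) | β∈
    ...     | d≡0 | here refl = ⊥-elim (<⇒≢ 0<d (sym (trans d≡0 (subMod-self 0))))
    ...     | d≡  | there β∈X = subst (_∈ map (pairDiff m) X) (sym d≡) (∈-map⁺ (pairDiff m) β∈X)

    nonzero : d ∈ map (pairDiff m) X → Zstar m d
    nonzero d∈ with ∈-map⁻ (pairDiff m) d∈
    ... | β , β∈X , refl = n≢0⇒n>0 βdiff≢0 , subMod<k _ _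
      where
      β₁∈ℤ* : Zstar m (proj₁ β)
      β₁∈ℤ* = from (proj₁ (proj₂ X-nucleus) (proj₁ β)) (∈-map⁺ proj₁ β∈X)
      βdiff≢0 : pairDiff m β ≢ 0
      βdiff≢0 βdiff≡0 with mapBothWays-injective (pairDiff N) false (starter-differences-unique {P = W} W-starter)
                             (∈-W-typeI α∈ (here refl)) (∈-W-typeI α∈ (there β∈X))
                             (from (pairDiff-typeI-≡⇔ α β (0 , 0)) (trans βdiff≡0 (sym (subMod-self 0))))
      ... | _ , typeIβ≡typeI0 = <⇒≢ (proj₁ β₁∈ℤ*) (sym (begin
        proj₁ β          ≡⟨ m<n⇒m%n≡m (proj₂ β₁∈ℤ*) ⟨
        proj₁ β % m      ≡⟨ typeI-injective₁ α β (0 , 0) (cong proj₁ typeIβ≡typeI0) ⟩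
        0 % m            ≡⟨ m<n⇒m%n≡m (>-nonZero⁻¹ m) ⟩
        0                ∎))

theorem3p17 : (n m : ℕ) → 3 ≤ n → 3 ≤ m → n % 2 ≡ 1 → m % 2 ≡ 1 →
    (S T X S̃ T̃ : List (ℕ × ℕ)) →
    IsTwoPartition n S → IsTwoPartition m T → Nucleus m X →
    Orientation S S̃ → Orientation T T̃ →
    (Starter (n * m) (XProduct n m S̃ T̃ X) ⇔ (Subtractive m X × Starter n S × Starter m T))
theorem3p17 n@(suc _) m@(suc _) 3≤n _ _ _ S T X S̃ T̃ S-partition T-partition X-nucleus S∼S̃ T∼T̃ =
  mk⇔ forward backward
  where
  open XProductOf n m S̃ T̃ X
  S̃-partition : IsTwoPartition n S̃
  S̃-partition = orient-partition {n} S∼S̃ S-partition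
  S-starter⇔ : Starter n S ⇔ DifferenceCovering n S̃
  S-starter⇔ = ⇔-trans (starter⇔covering {P = S} S-partition) (covering-orientation S∼S̃)
  T-starter⇔ : Starter m T ⇔ DifferenceCovering m T̃
  T-starter⇔ = ⇔-trans (starter⇔covering {P = T} T-partition) (covering-orientation T∼T̃)
  W-starter⇔ : Starter (n * m) W ⇔ DifferenceCovering (n * m) W
  W-starter⇔ = starter⇔covering {P = W}
    (XProduct-partition S̃-partition (orient-partition {m} T∼T̃ T-partition) X-nucleus)

  forward : Starter (n * m) W → Subtractive m X × Starter n S × Starter m T
  forward W-starter =
    subtractive (<⇒≤ 3≤n) S̃-partition X-nucleus W-starter ,
    from S-starter⇔ (covering-S W-covering) ,
    from T-starter⇔ (covering-T S̃-partition W-covering)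
    where
    W-covering : DifferenceCovering (n * m) W
    W-covering = to W-starter⇔ W-starter

  backward : Subtractive m X × Starter n S × Starter m T → Starter (n * m) W
  backward (X-subtractive , S-starter , T-starter) =
    from W-starter⇔ (covering-W S̃-partition X-subtractive (to S-starter⇔ S-starter) (to T-starter⇔ T-starter))
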